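{- The polynomials $f^*(n,q)$ satisfy: (a) for each $n\ge 2$, $\deg f^*(n,q)=2n-4$ and its leading coefficient is $1$; (b) for any integers $3\le n<n'$, we have $f^*(n,q)<_{\mathrm{lex}} f^*(n',q)$, and the first difference between their coefficient sequences is in the $n$-th entry (the term of $n$-th highest order), where the two entries differ by exactly $1$.
   Context: For $n\ge 1$, a function $\phi$ on $\{ -1,\dots,n-1\}$ with $\phi(-1)=0$, and an integer $-1\le k\le\frac{n-1}{2}$, set $u(\phi,n,q,k)=q^{2k+2}\phi(n-k-1)+\phi(k)+\sum_{i=0}^{k}q^i\sum_{j=k}^{n-2}q^j$. For a positive integer $n$ let $k^*(n)=n-2^{\lfloor\log_2 n\rfloor}$. Define polynomials $f^*(n,q)\in\mathbb{Z}[q]$ by $f^*(-1,q)=f^*(0,q)=f^*(1,q)=0$, $f^*(2,q)=1$, $f^*(3,q)=q^2+1$, $f^*(4,q)=q^4+2q^2+q+1$, and $f^*(n,q)=u(f^*(\cdot,q),n,q,k^*(n))$ for $n\ge 5$. The coefficient sequence of a nonzero polynomial lists its coefficients starting from the leading coefficient in order of decreasing power, followed by infinitely many zeros. For polynomials $f,g$ with coefficient sequences $(a_i)$, $(b_i)$, $f<_{\mathrm{lex}}g$ means there is $i\ge1$ with $a_i<b_i$ and $a_j=b_j$ for all $j<i$. -}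

module Defs where

open import Data.Nat as ℕ using (ℕ; zero; suc; _∸_; _≤ᵇ_)
import Data.Nat
open import Data.Nat.Logarithm using (⌊log₂_⌋)
open import Data.Integer as ℤ using (ℤ; 0ℤ; 1ℤ)
open import Data.List using (List; []; _∷_; replicate; _++_; map; upTo; foldr; length)
open import Data.Bool using (if_then_else_)
open import Relation.Nullary.Decidable using (does)

-- Polynomials in ℤ[q] as lists of coefficients in INCREASING order of
-- powers: (c₀ ∷ c₁ ∷ …) represents c₀ + c₁ q + …  (trailing zeros allowed).
Poly : Set
Poly = List ℤ

coeff : Poly → ℕ → ℤ
coeff []       _       = 0ℤ
coeff (c ∷ _)  zero    = c
coeff (_ ∷ cs) (suc i) = coeff cs i

infixl 6 _⊕_
_⊕_ : Poly → Poly → Poly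
[]       ⊕ qs       = qs
(p ∷ ps) ⊕ []       = p ∷ ps
(p ∷ ps) ⊕ (q ∷ qs) = (p ℤ.+ q) ∷ (ps ⊕ qs)

shift : ℕ → Poly → Poly
shift k p = replicate k 0ℤ ++ p

mono : ℕ → Poly
mono j = shift j (1ℤ ∷ [])

psum : List Poly → Poly
psum = foldr _⊕_ []

-- Σ_{j=a}^{b} F j   (empty when b < a)
Σ[_⋯_] : ℕ → ℕ → (ℕ → Poly) → Poly
Σ[ a ⋯ b ] F = psum (map (λ t → F (a ℕ.+ t)) (upTo (suc b ∸ a)))

-- u(φ,n,q,k) = q^{2k+2} φ(n-k-1) + φ(k) + Σ_{i=0}^{k} q^i Σ_{j=k}^{n-2} q^j
-- (used only with 0 ≤ k, so φ is indexed by ℕ)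
u : (ℕ → Poly) → ℕ → ℕ → Poly
u φ n k = shift (2 ℕ.* k ℕ.+ 2) (φ (n ∸ k ∸ 1)) ⊕ φ k
        ⊕ Σ[ 0 ⋯ k ] (λ i → shift i (Σ[ k ⋯ n ∸ 2 ] mono))

kstar : ℕ → ℕ
kstar n = n ∸ 2 ℕ.^ ⌊log₂ n ⌋

-- f* with a fuel argument (structural recursion); all recursive calls are on
-- arguments < n, so fuel n+1 suffices and fstar n = fstarF (suc n) n.
fstarF : ℕ → ℕ → Poly
fstarF zero _ = []
fstarF (suc fuel) 0 = []
fstarF (suc fuel) 1 = []
fstarF (suc fuel) 2 = 1ℤ ∷ []
fstarF (suc fuel) 3 = 1ℤ ∷ 0ℤ ∷ 1ℤ ∷ []
fstarF (suc fuel) 4 = 1ℤ ∷ 1ℤ ∷ 2ℤ ∷ 0ℤ ∷ 1ℤ ∷ []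
  where 2ℤ = ℤ.+ 2
fstarF (suc fuel) n@(suc (suc (suc (suc (suc _))))) = u (fstarF fuel) n (kstar n)

-- f*(n,q) for n ≥ 0  (f*(-1,q) = 0 is never needed: k*(n) ≥ 0)
fstar : ℕ → Poly
fstar n = fstarF (suc n) n

trim : Poly → Poly
trim [] = []
trim (c ∷ cs) with trim cs
... | [] = if does (c ℤ.≟ 0ℤ) then [] else (c ∷ [])
... | d ∷ ds = c ∷ d ∷ ds

-- degree (for nonzero polynomials) and leading coefficient
deg : Poly → ℕ
deg p = length (trim p) ∸ 1

leading : Poly → ℤ
leading p = coeff p (deg p)

-- coefficient sequence, 1-indexed: seqEntry p i for i ≥ 1 is the i-th entry,
-- i.e. the coefficient of q^{deg p + 1 - i} for i ≤ deg p + 1, and 0 afterwards.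
-- (seqEntry p 0 is a dummy value, never used.)
seqEntry : Poly → ℕ → ℤ
seqEntry p zero    = 0ℤ
seqEntry p (suc m) = if m ≤ᵇ deg p then coeff p (deg p ∸ m) else 0ℤ

_<lex_ : Poly → Poly → Set
f <lex g = Σ ℕ λ i → (1 Data.Nat.≤ i) × (seqEntry f i ℤ.< seqEntry g i)
             × (∀ j → 1 Data.Nat.≤ j → j Data.Nat.< i → seqEntry f j ≡ seqEntry g j)
  where open import Data.Product using (Σ; _×_)
        open import Relation.Binary.PropositionalEquality using (_≡_)

{-# OPTIONS --safe #-}
-- Write n = 2^L + k with 0 ≤ k < 2^L, so that k = k*(n) and M := n - k - 1 = 2^L - 1. Then
-- f*(n) = q^{2k+2} f*(M) + f*(k) + R(k,k,n-2), where R(a,k,b) = rectangle a k b is the product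
-- (1 + ⋯ + q^a)(q^k + ⋯ + q^b), and strong induction gives deg f*(n) ≤ 2n - 4.
-- From n to n + 1 either k and M stay in the same block (k ↦ k + 1) or a new block starts
-- (k*(n+1) = 0, M = n). In both cases the coefficients of q^{2+d}, d ≥ n - 3, of f*(n+1) are
-- those of q² f*(n) + q^{n-1}: f*(k) is too small to reach them, the terms q^{2k+2} f*(M) agree,
-- and R(k+1,k+1,n-1) = (q^{k+1} + ⋯ + q^{n-1}) + q² R(k,k,n-2).
-- On coefficient sequences: the first n - 1 entries of f*(n), starting with the leading 1 inherited
-- from f*(2) = 1, persist in every later f*(n′), while the n-th entry grows by exactly 1 at the
-- step n → n + 1 and then stays.
module Submission where

open import Defs
open import Data.Nat using (ℕ; _≤_; _<_; _∸_; _*_)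
open import Data.Integer using (ℤ; ∣_∣; _-_; 1ℤ)
open import Data.Product using (_×_)
open import Relation.Binary.PropositionalEquality using (_≡_)

open import Data.Bool using (true)
open import Data.Empty using (⊥-elim)
open import Data.Integer as ℤ using (0ℤ) renaming (_+_ to _+ℤ_)
import Data.Integer.Properties as ℤₚ
open import Algebra.Properties.AbelianGroup ℤₚ.+-0-abelianGroup using (xyx⁻¹≈y)
open import Algebra.Properties.CommutativeSemigroup ℤₚ.+-commutativeSemigroup using (x∙yz≈xz∙y)
open import Data.List using ([]; _∷_; applyUpTo; length)
open import Data.List.Properties using (map-upTo)
open import Data.Nat as ℕ
  using (zero; suc; _+_; _^_; ⌊_/2⌋; _≤ᵇ_; z≤n; s≤s; _≤′_; ≤′-refl; ≤′-step)
open import Data.Nat.Properties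
open import Data.Nat.Induction using (<-rec)
open import Data.Nat.Tactic.RingSolver using (solve-∀)
open import Data.Nat.Logarithm
  using (⌊log₂_⌋; ⌊log₂⌋-mono-≤; ⌊log₂⌊n/2⌋⌋≡⌊log₂n⌋∸1; ⌊log₂[2^n]⌋≡n)
open import Data.Product using (_,_; ∃₂)
open import Data.Sum using (_⊎_; inj₁; inj₂)
open import Function using (_∘_)
open import Relation.Nullary using (yes; no)
open import Relation.Binary.PropositionalEquality
  using (refl; sym; trans; cong; cong₂; subst; subst₂; _≢_; module ≡-Reasoning)

m<o∸n⇒n+m<o : ∀ n {m o} → m < o ∸ n → n + m < o
m<o∸n⇒n+m<o zero               m<o   = m<o
m<o∸n⇒n+m<o (suc n) {o = suc o} m<o∸n = s≤s (m<o∸n⇒n+m<o n m<o∸n)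

2*n≡n+n : ∀ n → 2 * n ≡ n + n
2*n≡n+n n = cong (n +_) (+-identityʳ n)

x≤⌊n/2⌋ : ∀ {x n} → x + x ≤ n → x ≤ ⌊ n /2⌋
x≤⌊n/2⌋ {x} {n} 2x≤n = subst (_≤ ⌊ n /2⌋) (sym (n≡⌊n+n/2⌋ x)) (⌊n/2⌋-mono 2x≤n)

⌊n/2⌋<x : ∀ {x n} → n < x + x → ⌊ n /2⌋ < x
⌊n/2⌋<x {x} {n} n<2x = subst (⌊ n /2⌋ <_) (sym (n≡⌈n+n/2⌉ x)) (⌊n/2⌋-mono (s≤s n<2x))

⌊log₂⌋-unique : ∀ L {n} → 2 ^ L ≤ n → n < 2 ^ suc L → ⌊log₂ n ⌋ ≡ L
⌊log₂⌋-unique zero    {suc zero}    _ _ = refl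
⌊log₂⌋-unique zero    {suc (suc _)} _ (s≤s (s≤s ()))
⌊log₂⌋-unique (suc L) {n} 2^[1+L]≤n n<2^[2+L] = begin
  ⌊log₂ n ⌋             ≡⟨ m+[n∸m]≡n 1≤⌊log₂n⌋ ⟨
  suc (⌊log₂ n ⌋ ∸ 1)   ≡⟨ cong suc (⌊log₂⌊n/2⌋⌋≡⌊log₂n⌋∸1 n) ⟨
  suc ⌊log₂ ⌊ n /2⌋ ⌋   ≡⟨ cong suc (⌊log₂⌋-unique L 2^L≤⌊n/2⌋ ⌊n/2⌋<2^[1+L]) ⟩
  suc L                 ∎
  where
  open ≡-Reasoning
  1≤⌊log₂n⌋ : 1 ≤ ⌊log₂ n ⌋
  1≤⌊log₂n⌋ = ≤-trans (s≤s z≤n)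
    (subst (_≤ ⌊log₂ n ⌋) (⌊log₂[2^n]⌋≡n (suc L)) (⌊log₂⌋-mono-≤ 2^[1+L]≤n))
  2^L≤⌊n/2⌋ : 2 ^ L ≤ ⌊ n /2⌋
  2^L≤⌊n/2⌋ = x≤⌊n/2⌋ (subst (_≤ n) (2*n≡n+n (2 ^ L)) 2^[1+L]≤n)
  ⌊n/2⌋<2^[1+L] : ⌊ n /2⌋ < 2 ^ suc L
  ⌊n/2⌋<2^[1+L] = ⌊n/2⌋<x (subst (n <_) (2*n≡n+n (2 ^ suc L)) n<2^[2+L])

∑ : ℕ → (ℕ → ℤ) → ℤ
∑ zero    g = 0ℤ
∑ (suc L) g = g 0 +ℤ ∑ L (g ∘ suc)

∑-cong : ∀ L {g h : ℕ → ℤ} → (∀ {t} → t < L → g t ≡ h t) → ∑ L g ≡ ∑ L h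
∑-cong zero    _    = refl
∑-cong (suc L) g≡h = cong₂ _+ℤ_ (g≡h (s≤s z≤n)) (∑-cong L (g≡h ∘ s≤s))

∑-zero : ∀ L {g : ℕ → ℤ} → (∀ {t} → t < L → g t ≡ 0ℤ) → ∑ L g ≡ 0ℤ
∑-zero zero    _    = refl
∑-zero (suc L) g≡0 = cong₂ _+ℤ_ (g≡0 (s≤s z≤n)) (∑-zero L (g≡0 ∘ s≤s))

∑-single : ∀ {L} {g : ℕ → ℤ} c → c < L → (∀ {t} → t < L → t ≢ c → g t ≡ 0ℤ) → ∑ L g ≡ g c
∑-single {suc L} {g} zero _ g≡0 =
  trans (cong (g 0 +ℤ_) (∑-zero L (λ t<L → g≡0 (s≤s t<L) λ ()))) (ℤₚ.+-identityʳ (g 0))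
∑-single {suc L} (suc c) (s≤s c<L) g≡0 =
  trans (cong₂ _+ℤ_ (g≡0 (s≤s z≤n) λ ())
                    (∑-single c c<L λ t<L t≢c → g≡0 (s≤s t<L) (t≢c ∘ suc-injective)))
        (ℤₚ.+-identityˡ _)

infix 4 _≈_
_≈_ : Poly → Poly → Set
p ≈ q = ∀ d → coeff p d ≡ coeff q d

coeff-⊕ : ∀ p q d → coeff (p ⊕ q) d ≡ coeff p d +ℤ coeff q d
coeff-⊕ []       q        d       = sym (ℤₚ.+-identityˡ _)
coeff-⊕ (_ ∷ _)  []       d       = sym (ℤₚ.+-identityʳ _)
coeff-⊕ (_ ∷ _)  (_ ∷ _)  zero    = refl
coeff-⊕ (_ ∷ ps) (_ ∷ qs) (suc d) = coeff-⊕ ps qs d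

coeff-beyond-length : ∀ p {d} → length p ≤ d → coeff p d ≡ 0ℤ
coeff-beyond-length []       _           = refl
coeff-beyond-length (_ ∷ cs) (s≤s len≤d) = coeff-beyond-length cs len≤d

coeff-psum-applyUpTo : ∀ (G : ℕ → Poly) L d →
  coeff (psum (applyUpTo G L)) d ≡ ∑ L (λ t → coeff (G t) d)
coeff-psum-applyUpTo G zero    d = refl
coeff-psum-applyUpTo G (suc L) d =
  trans (coeff-⊕ (G 0) _ d) (cong (coeff (G 0) d +ℤ_) (coeff-psum-applyUpTo (G ∘ suc) L d))

coeff-Σ : ∀ a b F d → coeff (Σ[ a ⋯ b ] F) d ≡ ∑ (suc b ∸ a) (λ t → coeff (F (a + t)) d)
coeff-Σ a b F d = trans (cong (λ ps → coeff (psum ps) d) (map-upTo (λ t → F (a + t)) (suc b ∸ a)))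
                        (coeff-psum-applyUpTo (λ t → F (a + t)) (suc b ∸ a) d)

coeff-shift-vanishes : ∀ j p d → (∀ e → d ≡ j + e → coeff p e ≡ 0ℤ) → coeff (shift j p) d ≡ 0ℤ
coeff-shift-vanishes zero    p d       p≡0 = p≡0 d refl
coeff-shift-vanishes (suc j) p zero    _   = refl
coeff-shift-vanishes (suc j) p (suc d) p≡0 =
  coeff-shift-vanishes j p d (λ e d≡j+e → p≡0 e (cong suc d≡j+e))

shift-shift : ∀ i j p → shift i (shift j p) ≡ shift (i + j) p
shift-shift zero    j p = refl
shift-shift (suc i) j p = cong (0ℤ ∷_) (shift-shift i j p)

shift-cong : ∀ j {p q} → p ≈ q → shift j p ≈ shift j q
shift-cong zero    p≈q d       = p≈q d
shift-cong (suc j) p≈q zero    = refl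
shift-cong (suc j) p≈q (suc d) = shift-cong j p≈q d

coeff-shift-suc : ∀ i {p q} → p ≈ shift 1 q → ∀ d → coeff (shift i p) (suc d) ≡ coeff (shift i q) d
coeff-shift-suc i {p} {q} p≈q d = begin
  coeff (shift i p) (suc d)             ≡⟨ shift-cong i p≈q (suc d) ⟩
  coeff (shift i (shift 1 q)) (suc d)   ≡⟨ cong (λ r → coeff r (suc d)) (shift-shift i 1 q) ⟩
  coeff (shift (i + 1) q) (suc d)       ≡⟨ cong (λ j → coeff (shift j q) (suc d)) (+-comm i 1) ⟩
  coeff (shift i q) d                   ∎
  where open ≡-Reasoning

coeff-mono-≡ : ∀ j → coeff (mono j) j ≡ 1ℤ
coeff-mono-≡ zero    = refl
coeff-mono-≡ (suc j) = coeff-mono-≡ j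

coeff-mono-≢ : ∀ {j e} → j ≢ e → coeff (mono j) e ≡ 0ℤ
coeff-mono-≢ {zero}  {zero}  j≢e = ⊥-elim (j≢e refl)
coeff-mono-≢ {zero}  {suc e} _   = refl
coeff-mono-≢ {suc j} {zero}  _   = refl
coeff-mono-≢ {suc j} {suc e} j≢e = coeff-mono-≢ (j≢e ∘ cong suc)

trim-≡[] : ∀ p → (∀ e → coeff p e ≡ 0ℤ) → trim p ≡ []
trim-≡[] []       _   = refl
trim-≡[] (c ∷ cs) p≡0 with trim cs | trim-≡[] cs (p≡0 ∘ suc)
... | [] | refl rewrite p≡0 0 = refl

length-trim : ∀ p {D} → coeff p D ≢ 0ℤ → (∀ {e} → D < e → coeff p e ≡ 0ℤ) →
  length (trim p) ≡ suc D
length-trim [] pD≢0 _ = ⊥-elim (pD≢0 refl)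
length-trim (c ∷ cs) {zero} c≢0 above with trim cs | trim-≡[] cs (λ e → above (s≤s z≤n))
... | [] | refl with c ℤ.≟ 0ℤ
...   | yes c≡0 = ⊥-elim (c≢0 c≡0)
...   | no _    = refl
length-trim (c ∷ cs) {suc D} cD≢0 above with trim cs | length-trim cs cD≢0 (above ∘ s≤s)
... | []    | ()
... | _ ∷ _ | len≡1+D = cong suc len≡1+D

deg-≡ : ∀ p {D} → coeff p D ≢ 0ℤ → (∀ {e} → D < e → coeff p e ≡ 0ℤ) → deg p ≡ D
deg-≡ p pD≢0 above = cong (_∸ 1) (length-trim p pD≢0 above)

seqEntry-≤deg : ∀ p {j} → j ≤ deg p → seqEntry p (suc j) ≡ coeff p (deg p ∸ j)
seqEntry-≤deg p {j} j≤deg with j ≤ᵇ deg p | ≤⇒≤ᵇ j≤deg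
... | true | _ = refl

geom : ℕ → ℕ → Poly
geom a b = Σ[ a ⋯ b ] mono

coeff-geom-> : ∀ a b {e} → b < e → coeff (geom a b) e ≡ 0ℤ
coeff-geom-> a b {e} b<e = trans (coeff-Σ a b mono e) (∑-zero (suc b ∸ a) λ t<L →
  coeff-mono-≢ (<⇒≢ (≤-<-trans (ℕ.s≤s⁻¹ (m<o∸n⇒n+m<o a t<L)) b<e)))

coeff-geom-top : ∀ {a b} → a ≤ b → coeff (geom a b) b ≡ 1ℤ
coeff-geom-top {a} {b} a≤b = begin
  coeff (geom a b) b                 ≡⟨ coeff-Σ a b mono b ⟩
  ∑ (suc b ∸ a) (λ t → coeff (mono (a + t)) b)
    ≡⟨ ∑-single (b ∸ a) (subst (b ∸ a <_) (sym (+-∸-assoc 1 a≤b)) ≤-refl) a+t≢b ⟩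
  coeff (mono (a + (b ∸ a))) b       ≡⟨ cong (λ j → coeff (mono j) b) (m+[n∸m]≡n a≤b) ⟩
  coeff (mono b) b                   ≡⟨ coeff-mono-≡ b ⟩
  1ℤ                                 ∎
  where
  open ≡-Reasoning
  a+t≢b : ∀ {t} → t < suc b ∸ a → t ≢ b ∸ a → coeff (mono (a + t)) b ≡ 0ℤ
  a+t≢b {t} _ t≢b∸a =
    coeff-mono-≢ λ a+t≡b → t≢b∸a (trans (sym (m+n∸m≡n a t)) (cong (_∸ a) a+t≡b))

coeff-geom-≥ : ∀ {a b e} → a ≤ b → b ≤ e → coeff (geom a b) e ≡ coeff (mono b) e
coeff-geom-≥ {a} {b} a≤b b≤e with m≤n⇒m<n∨m≡n b≤e
... | inj₁ b<e  = trans (coeff-geom-> a b b<e) (sym (coeff-mono-≢ (<⇒≢ b<e)))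
... | inj₂ refl = trans (coeff-geom-top a≤b) (sym (coeff-mono-≡ b))

geom-suc : ∀ a b → geom (suc a) (suc b) ≈ shift 1 (geom a b)
geom-suc a b zero    = trans (coeff-Σ (suc a) (suc b) mono 0) (∑-zero (suc b ∸ a) λ _ → refl)
geom-suc a b (suc d) = trans (coeff-Σ (suc a) (suc b) mono (suc d)) (sym (coeff-Σ a b mono d))

rectangle : ℕ → ℕ → ℕ → Poly
rectangle a k b = Σ[ 0 ⋯ a ] (λ i → shift i (geom k b))

coeff-rectangle-vanishes : ∀ a k b {d} → a + b < d → coeff (rectangle a k b) d ≡ 0ℤ
coeff-rectangle-vanishes a k b {d} a+b<d =
  trans (coeff-Σ 0 a (λ i → shift i (geom k b)) d) (∑-zero (suc a) λ {i} i<1+a →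
    coeff-shift-vanishes i (geom k b) d λ e d≡i+e → coeff-geom-> k b (b<e i<1+a d≡i+e))
  where
  b<e : ∀ {i e} → i < suc a → d ≡ i + e → b < e
  b<e {i} {e} i<1+a d≡i+e =
    +-cancelˡ-< a b e (<-≤-trans a+b<d (≤-trans (≤-reflexive d≡i+e) (+-monoˡ-≤ e (ℕ.s≤s⁻¹ i<1+a))))

rectangle-zero : ∀ k b → rectangle 0 k b ≈ geom k b
rectangle-zero k b d = trans (coeff-Σ 0 0 (λ i → shift i (geom k b)) d) (ℤₚ.+-identityʳ _)

coeff-rectangle-suc : ∀ a k b d →
  coeff (rectangle (suc a) (suc k) (suc b)) (2 + d) ≡
  coeff (geom (suc k) (suc b)) (2 + d) +ℤ coeff (rectangle a k b) d
coeff-rectangle-suc a k b d = begin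
  coeff (rectangle (suc a) (suc k) (suc b)) (2 + d)
    ≡⟨ coeff-Σ 0 (suc a) (λ i → shift i G′) (2 + d) ⟩
  coeff G′ (2 + d) +ℤ ∑ (suc a) (λ i → coeff (shift i G′) (1 + d))
    ≡⟨ cong (coeff G′ (2 + d) +ℤ_) (∑-cong (suc a) λ {i} _ → coeff-shift-suc i {G′} (geom-suc k b) d) ⟩
  coeff G′ (2 + d) +ℤ ∑ (suc a) (λ i → coeff (shift i (geom k b)) d)
    ≡⟨ cong (coeff G′ (2 + d) +ℤ_) (coeff-Σ 0 a (λ i → shift i (geom k b)) d) ⟨
  coeff G′ (2 + d) +ℤ coeff (rectangle a k b) d
    ∎
  where
  open ≡-Reasoning
  G′ = geom (suc k) (suc b)

u-cong : ∀ φ ψ n k → φ (n ∸ k ∸ 1) ≡ ψ (n ∸ k ∸ 1) → φ k ≡ ψ k → u φ n k ≡ u ψ n k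
u-cong φ ψ n k = cong₂ (λ x y → shift (2 * k + 2) x ⊕ y ⊕ rectangle k k (n ∸ 2))

kstar<n : ∀ n → kstar (suc n) < suc n
kstar<n n = s≤s (∸-monoʳ-≤ (suc n) (m^n>0 2 ⌊log₂ suc n ⌋))

n∸k∸1<n : ∀ n k → suc n ∸ k ∸ 1 < suc n
n∸k∸1<n n k = s≤s (∸-monoˡ-≤ 1 (m∸n≤m (suc n) k))

fstarF-fuel : ∀ f g n → n < f → n < g → fstarF f n ≡ fstarF g n
fstarF-fuel (suc f) (suc g) 0 _ _ = refl
fstarF-fuel (suc f) (suc g) 1 _ _ = refl
fstarF-fuel (suc f) (suc g) 2 _ _ = refl
fstarF-fuel (suc f) (suc g) 3 _ _ = refl
fstarF-fuel (suc f) (suc g) 4 _ _ = refl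
fstarF-fuel (suc f) (suc g) n@(suc (suc (suc (suc (suc n₀))))) (s≤s n≤f) (s≤s n≤g) =
  u-cong (fstarF f) (fstarF g) n k
    (fstarF-fuel f g _ (<-≤-trans M<n n≤f) (<-≤-trans M<n n≤g))
    (fstarF-fuel f g _ (<-≤-trans k<n n≤f) (<-≤-trans k<n n≤g))
  where
  k = kstar n
  k<n = kstar<n (4 + n₀)
  M<n = n∸k∸1<n (4 + n₀) k

-- The listed value of f*(4) is also the one given by the recursion, with k*(4) = 0.
fstar-unfold : ∀ n → 4 ≤ n → fstar n ≡ u fstar n (kstar n)
fstar-unfold 0 ()
fstar-unfold 1 (s≤s ())
fstar-unfold 2 (s≤s (s≤s ()))
fstar-unfold 3 (s≤s (s≤s (s≤s ())))
fstar-unfold 4 _ = refl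
fstar-unfold n@(suc (suc (suc (suc (suc n₀))))) _ =
  u-cong (fstarF n) fstar n k
    (fstarF-fuel n (suc (n ∸ k ∸ 1)) _ (n∸k∸1<n (4 + n₀) k) ≤-refl)
    (fstarF-fuel n (suc k) k (kstar<n (4 + n₀)) ≤-refl)
  where k = kstar n

record DyadicSplit (n M k : ℕ) : Set where
  field
    L       : ℕ
    1+M≡2^L : suc M ≡ 2 ^ L
    n≡1+M+k : n ≡ suc M + k
    k≤M     : k ≤ M
    3≤M     : 3 ≤ M

module _ {n M k} (s : DyadicSplit n M k) where
  open DyadicSplit s

  kstar-split : kstar n ≡ k
  kstar-split = begin
    n ∸ 2 ^ ⌊log₂ n ⌋   ≡⟨ cong (λ e → n ∸ 2 ^ e) (⌊log₂⌋-unique L 2^L≤n n<2^[1+L]) ⟩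
    n ∸ 2 ^ L           ≡⟨ cong₂ _∸_ (sym n≡1+M+k) 1+M≡2^L ⟨
    suc M + k ∸ suc M   ≡⟨ m+n∸m≡n (suc M) k ⟩
    k                   ∎
    where
    open ≡-Reasoning
    2^L≤n : 2 ^ L ≤ n
    2^L≤n = subst₂ _≤_ 1+M≡2^L (sym n≡1+M+k) (m≤m+n (suc M) k)
    n<2^[1+L] : n < 2 ^ suc L
    n<2^[1+L] = subst₂ _<_ (sym n≡1+M+k)
                (trans (cong₂ _+_ 1+M≡2^L 1+M≡2^L) (sym (2*n≡n+n (2 ^ L))))
                (+-monoʳ-< (suc M) (s≤s k≤M))

  n∸k∸1≡M : n ∸ k ∸ 1 ≡ M
  n∸k∸1≡M = trans (cong (λ m → m ∸ k ∸ 1) n≡1+M+k) (cong (_∸ 1) (m+n∸n≡m (suc M) k))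

  M<n : M < n
  M<n = subst (M <_) (sym n≡1+M+k) (s≤s (m≤m+n M k))

  k<n : k < n
  k<n = subst (k <_) (sym n≡1+M+k) (s≤s (m≤n+m k M))

  4≤n : 4 ≤ n
  4≤n = ≤-trans (s≤s 3≤M) M<n

  2+k≤n : 2 + k ≤ n
  2+k≤n = subst (2 + k ≤_) (sym n≡1+M+k) (+-monoˡ-≤ k (s≤s (≤-trans (s≤s z≤n) 3≤M)))

  fstar-split : fstar n ≡ shift (2 * k + 2) (fstar M) ⊕ fstar k ⊕ rectangle k k (n ∸ 2)
  fstar-split = begin
    fstar n               ≡⟨ fstar-unfold n 4≤n ⟩
    u fstar n (kstar n)   ≡⟨ cong (u fstar n) kstar-split ⟩
    u fstar n k
      ≡⟨ cong (λ m → shift (2 * k + 2) (fstar m) ⊕ fstar k ⊕ rectangle k k (n ∸ 2)) n∸k∸1≡M ⟩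
    shift (2 * k + 2) (fstar M) ⊕ fstar k ⊕ rectangle k k (n ∸ 2) ∎
    where open ≡-Reasoning

  coeff-fstar-split : ∀ d → coeff (fstar n) d ≡
    coeff (shift (2 * k + 2) (fstar M)) d +ℤ coeff (fstar k) d +ℤ coeff (rectangle k k (n ∸ 2)) d
  coeff-fstar-split d = begin
    coeff (fstar n) d                            ≡⟨ cong (λ p → coeff p d) fstar-split ⟩
    coeff (S ⊕ fstar k ⊕ R) d                    ≡⟨ coeff-⊕ (S ⊕ fstar k) R d ⟩
    coeff (S ⊕ fstar k) d +ℤ coeff R d           ≡⟨ cong (_+ℤ coeff R d) (coeff-⊕ S (fstar k) d) ⟩
    coeff S d +ℤ coeff (fstar k) d +ℤ coeff R d  ∎
    where
    open ≡-Reasoning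
    S = shift (2 * k + 2) (fstar M)
    R = rectangle k k (n ∸ 2)

  split-suc : DyadicSplit (suc n) M (suc k) ⊎ DyadicSplit (suc n) n 0
  split-suc with m≤n⇒m<n∨m≡n k≤M
  ... | inj₁ k<M = inj₁ record
    { L = L ; 1+M≡2^L = 1+M≡2^L ; n≡1+M+k = trans (cong suc n≡1+M+k) (sym (+-suc (suc M) k))
    ; k≤M = k<M ; 3≤M = 3≤M }
  ... | inj₂ refl = inj₂ record
    { L = suc L ; 1+M≡2^L = 1+n≡2^[1+L] ; n≡1+M+k = cong suc (sym (+-identityʳ n))
    ; k≤M = z≤n ; 3≤M = ≤-trans 3≤M (<⇒≤ M<n) }
    where
    open ≡-Reasoning
    1+n≡2^[1+L] : suc n ≡ 2 ^ suc L
    1+n≡2^[1+L] = begin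
      suc n           ≡⟨ cong suc n≡1+M+k ⟩
      suc (suc M + M) ≡⟨ +-suc (suc M) M ⟨
      suc M + suc M   ≡⟨ cong₂ _+_ 1+M≡2^L 1+M≡2^L ⟩
      2 ^ L + 2 ^ L   ≡⟨ 2*n≡n+n (2 ^ L) ⟨
      2 ^ suc L       ∎

dyadicSplit : ∀ j → ∃₂ (DyadicSplit (4 + j))
dyadicSplit zero =
  3 , 0 , record { L = 2 ; 1+M≡2^L = refl ; n≡1+M+k = refl ; k≤M = z≤n ; 3≤M = ≤-refl }
dyadicSplit (suc j) with dyadicSplit j
... | M , k , s with split-suc s
...   | inj₁ s′ = M , suc k , s′
...   | inj₂ s′ = 4 + j , 0 , s′

coeff-fstar-vanishes : ∀ n d → 2 * n ≤ 3 + d → coeff (fstar n) d ≡ 0ℤ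
coeff-fstar-vanishes = <-rec _ vanishes
  where
  vanishes : ∀ n → (∀ {m} → m < n → ∀ d → 2 * m ≤ 3 + d → coeff (fstar m) d ≡ 0ℤ) →
             ∀ d → 2 * n ≤ 3 + d → coeff (fstar n) d ≡ 0ℤ
  vanishes 0 _ _ _ = refl
  vanishes 1 _ _ _ = refl
  vanishes 2 _ d 4≤3+d = coeff-beyond-length (fstar 2) (+-cancelˡ-≤ 3 1 d 4≤3+d)
  vanishes 3 _ d 6≤3+d = coeff-beyond-length (fstar 3) (+-cancelˡ-≤ 3 3 d 6≤3+d)
  vanishes n@(suc (suc (suc (suc j)))) rec d 2n≤3+d with dyadicSplit j
  ... | M , k , s = begin
    coeff (fstar n) d
      ≡⟨ coeff-fstar-split s d ⟩
    coeff (shift (2 * k + 2) (fstar M)) d +ℤ coeff (fstar k) d +ℤ coeff (rectangle k k (2 + j)) d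
      ≡⟨ cong₂ _+ℤ_ (cong₂ _+ℤ_ shifted-M-vanishes (rec (k<n s) d 2k≤3+d))
                    (coeff-rectangle-vanishes k k (2 + j) k+[2+j]<d) ⟩
    0ℤ ∎
    where
    open ≡-Reasoning
    open DyadicSplit s
    k≤2+j : k ≤ 2 + j
    k≤2+j = ℕ.s≤s⁻¹ (ℕ.s≤s⁻¹ (2+k≤n s))
    2k≤3+d : 2 * k ≤ 3 + d
    2k≤3+d = ≤-trans (*-monoʳ-≤ 2 (<⇒≤ (k<n s))) 2n≤3+d
    k+[2+j]<d : k + (2 + j) < d
    k+[2+j]<d = ≤-<-trans (+-monoˡ-≤ (2 + j) k≤2+j)
                  (+-cancelˡ-≤ 3 _ d (subst (_≤ 3 + d) (2[4+j]≡3+[1+[2+j]+[2+j]] j) 2n≤3+d))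
      where
      2[4+j]≡3+[1+[2+j]+[2+j]] : ∀ j → 2 * (4 + j) ≡ 3 + suc ((2 + j) + (2 + j))
      2[4+j]≡3+[1+[2+j]+[2+j]] = solve-∀
    2M≤3+e : ∀ e → d ≡ 2 * k + 2 + e → 2 * M ≤ 3 + e
    2M≤3+e e d≡2k+2+e = +-cancelˡ-≤ (2 * k + 2) _ _
      (subst₂ _≤_ (2[1+M+k]≡ M k) (trans (cong (3 +_) d≡2k+2+e) (3+d≡ k e))
                  (subst (λ x → 2 * x ≤ 3 + d) n≡1+M+k 2n≤3+d))
      where
      2[1+M+k]≡ : ∀ M k → 2 * (suc M + k) ≡ 2 * k + 2 + 2 * M
      2[1+M+k]≡ = solve-∀
      3+d≡ : ∀ k e → 3 + (2 * k + 2 + e) ≡ 2 * k + 2 + (3 + e)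
      3+d≡ = solve-∀
    shifted-M-vanishes : coeff (shift (2 * k + 2) (fstar M)) d ≡ 0ℤ
    shifted-M-vanishes =
      coeff-shift-vanishes (2 * k + 2) (fstar M) d λ e d≡2k+2+e → rec (M<n s) e (2M≤3+e e d≡2k+2+e)

coeff-fstar-top : ∀ {n M k d} → DyadicSplit n M k → n ≤ 3 + d →
  coeff (fstar n) d ≡ coeff (shift (2 * k + 2) (fstar M)) d +ℤ coeff (rectangle k k (n ∸ 2)) d
coeff-fstar-top {n} {M} {k} {d} s n≤3+d = begin
  coeff (fstar n) d            ≡⟨ coeff-fstar-split s d ⟩
  a +ℤ coeff (fstar k) d +ℤ c  ≡⟨ cong (λ x → a +ℤ x +ℤ c) (coeff-fstar-vanishes k d 2k≤3+d) ⟩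
  a +ℤ 0ℤ +ℤ c                 ≡⟨ cong (_+ℤ c) (ℤₚ.+-identityʳ a) ⟩
  a +ℤ c                       ∎
  where
  open ≡-Reasoning
  open DyadicSplit s
  a = coeff (shift (2 * k + 2) (fstar M)) d
  c = coeff (rectangle k k (n ∸ 2)) d
  2k≤3+d : 2 * k ≤ 3 + d
  2k≤3+d = ≤-trans (≤-reflexive (2*n≡n+n k)) (≤-trans (+-monoˡ-≤ k k≤M)
             (≤-trans (n≤1+n (M + k)) (subst (_≤ 3 + d) n≡1+M+k n≤3+d)))

coeff-fstar-suc : ∀ n {d} → 2 ≤ n → n ≤ 3 + d →
  coeff (fstar (suc n)) (2 + d) ≡ coeff (fstar n) d +ℤ coeff (mono (n ∸ 1)) (2 + d)
coeff-fstar-suc 0 () _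
coeff-fstar-suc 1 (s≤s ()) _
coeff-fstar-suc 2 {zero}  _ _ = refl
coeff-fstar-suc 2 {suc d} _ _ = refl
coeff-fstar-suc 3 {0} _ _ = refl
coeff-fstar-suc 3 {1} _ _ = refl
coeff-fstar-suc 3 {2} _ _ = refl
coeff-fstar-suc 3 {suc (suc (suc d))} _ _ = refl
coeff-fstar-suc n@(suc (suc (suc (suc j)))) {d} _ n≤3+d with dyadicSplit j
... | M , k , s with split-suc s
...   | inj₁ s′ = begin
  coeff (fstar (suc n)) (2 + d)
    ≡⟨ coeff-fstar-top s′ (m≤n⇒m≤1+n (s≤s n≤3+d)) ⟩
  coeff (shift (2 * suc k + 2) (fstar M)) (2 + d) +ℤ coeff (rectangle (suc k) (suc k) (3 + j)) (2 + d)
    ≡⟨ cong₂ _+ℤ_ (cong (λ i → coeff (shift i (fstar M)) (2 + d)) (cong (_+ 2) (*-suc 2 k)))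
                  (coeff-rectangle-suc k k (2 + j) d) ⟩
  A +ℤ (G +ℤ R)
    ≡⟨ x∙yz≈xz∙y A G R ⟩
  A +ℤ R +ℤ G
    ≡⟨ cong₂ _+ℤ_ (sym (coeff-fstar-top s n≤3+d)) (coeff-geom-≥ (ℕ.s≤s⁻¹ (2+k≤n s)) (ℕ.s≤s⁻¹ n≤3+d)) ⟩
  coeff (fstar n) d +ℤ coeff (mono (3 + j)) (2 + d) ∎
  where
  open ≡-Reasoning
  A = coeff (shift (2 * k + 2) (fstar M)) d
  G = coeff (geom (suc k) (3 + j)) (2 + d)
  R = coeff (rectangle k k (2 + j)) d
...   | inj₂ s′ = begin
  coeff (fstar (suc n)) (2 + d)
    ≡⟨ coeff-fstar-top s′ (m≤n⇒m≤1+n (s≤s n≤3+d)) ⟩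
  coeff (fstar n) d +ℤ coeff (rectangle 0 0 (3 + j)) (2 + d)
    ≡⟨ cong (coeff (fstar n) d +ℤ_)
            (trans (rectangle-zero 0 (3 + j) (2 + d)) (coeff-geom-≥ z≤n (ℕ.s≤s⁻¹ n≤3+d))) ⟩
  coeff (fstar n) d +ℤ coeff (mono (3 + j)) (2 + d) ∎
  where open ≡-Reasoning

coeff-fstar-leading : ∀ m → coeff (fstar (2 + m)) (2 * m) ≡ 1ℤ
coeff-fstar-leading zero    = refl
coeff-fstar-leading (suc m) = begin
  coeff (fstar (3 + m)) (2 * suc m)
    ≡⟨ cong (coeff (fstar (3 + m))) (*-suc 2 m) ⟩
  coeff (fstar (3 + m)) (2 + 2 * m)
    ≡⟨ coeff-fstar-suc (2 + m) (s≤s (s≤s z≤n)) (s≤s (s≤s (m≤n⇒m≤1+n m≤2m))) ⟩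
  coeff (fstar (2 + m)) (2 * m) +ℤ coeff (mono (suc m)) (2 + 2 * m)
    ≡⟨ cong₂ _+ℤ_ (coeff-fstar-leading m) (coeff-mono-≢ (<⇒≢ (s≤s (s≤s m≤2m)))) ⟩
  1ℤ ∎
  where
  open ≡-Reasoning
  m≤2m : m ≤ 2 * m
  m≤2m = m≤m+n m (m + 0)

deg-fstar : ∀ m → deg (fstar (2 + m)) ≡ 2 * m
deg-fstar m = deg-≡ (fstar (2 + m)) lead≢0 λ {e} 2m<e →
  coeff-fstar-vanishes (2 + m) e (subst (_≤ 3 + e) (sym (2[2+m]≡3+[1+2m] m)) (+-monoʳ-≤ 3 2m<e))
  where
  lead≢0 : coeff (fstar (2 + m)) (2 * m) ≢ 0ℤ
  lead≢0 lead≡0 with trans (sym (coeff-fstar-leading m)) lead≡0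
  ... | ()
  2[2+m]≡3+[1+2m] : ∀ m → 2 * (2 + m) ≡ 3 + suc (2 * m)
  2[2+m]≡3+[1+2m] = solve-∀

seqEntry-fstar : ∀ m {j d} → j + d ≡ 2 * m → seqEntry (fstar (2 + m)) (suc j) ≡ coeff (fstar (2 + m)) d
seqEntry-fstar m {j} {d} j+d≡2m = begin
  seqEntry f (suc j)      ≡⟨ seqEntry-≤deg f j≤deg ⟩
  coeff f (deg f ∸ j)     ≡⟨ cong (λ e → coeff f (e ∸ j)) (trans (deg-fstar m) (sym j+d≡2m)) ⟩
  coeff f (j + d ∸ j)     ≡⟨ cong (coeff f) (m+n∸m≡n j d) ⟩
  coeff f d               ∎
  where
  open ≡-Reasoning
  f = fstar (2 + m)
  j≤deg : j ≤ deg f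
  j≤deg = subst (j ≤_) (trans j+d≡2m (sym (deg-fstar m))) (m≤m+n j d)

seqEntry-fstar-suc : ∀ m {j d} → j + d ≡ 2 * m → m ≤ suc d →
  seqEntry (fstar (3 + m)) (suc j) ≡ seqEntry (fstar (2 + m)) (suc j) +ℤ coeff (mono (suc m)) (2 + d)
seqEntry-fstar-suc m {j} {d} j+d≡2m m≤1+d = begin
  seqEntry (fstar (3 + m)) (suc j)
    ≡⟨ seqEntry-fstar (suc m) j+[2+d]≡2[1+m] ⟩
  coeff (fstar (3 + m)) (2 + d)
    ≡⟨ coeff-fstar-suc (2 + m) (s≤s (s≤s z≤n)) (s≤s (s≤s m≤1+d)) ⟩
  coeff (fstar (2 + m)) d +ℤ coeff (mono (suc m)) (2 + d)
    ≡⟨ cong (_+ℤ coeff (mono (suc m)) (2 + d)) (seqEntry-fstar m j+d≡2m) ⟨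
  seqEntry (fstar (2 + m)) (suc j) +ℤ coeff (mono (suc m)) (2 + d) ∎
  where
  open ≡-Reasoning
  j+[2+d]≡2[1+m] : j + (2 + d) ≡ 2 * suc m
  j+[2+d]≡2[1+m] = trans (+-suc j (suc d)) (trans (cong suc (+-suc j d))
                     (trans (cong (2 +_) j+d≡2m) (sym (*-suc 2 m))))

seqEntry-fstar-suc-< : ∀ {n i} → 2 ≤ n → 1 ≤ i → i < n →
  seqEntry (fstar (suc n)) i ≡ seqEntry (fstar n) i
seqEntry-fstar-suc-< {suc (suc m)} {suc j} _ _ (s≤s (s≤s j≤m)) = begin
  seqEntry (fstar (3 + m)) (suc j)
    ≡⟨ seqEntry-fstar-suc m (m+[n∸m]≡n j≤2m) (m≤n⇒m≤1+n m≤d) ⟩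
  seqEntry (fstar (2 + m)) (suc j) +ℤ coeff (mono (suc m)) (2 + d)
    ≡⟨ cong (seqEntry (fstar (2 + m)) (suc j) +ℤ_) (coeff-mono-≢ (<⇒≢ (s≤s (s≤s m≤d)))) ⟩
  seqEntry (fstar (2 + m)) (suc j) +ℤ 0ℤ
    ≡⟨ ℤₚ.+-identityʳ _ ⟩
  seqEntry (fstar (2 + m)) (suc j) ∎
  where
  open ≡-Reasoning
  d = 2 * m ∸ j
  j≤2m : j ≤ 2 * m
  j≤2m = subst (j ≤_) (sym (2*n≡n+n m)) (≤-trans j≤m (m≤m+n m m))
  m≤d : m ≤ d
  m≤d = m+n≤o⇒m≤o∸n m (subst (m + j ≤_) (sym (2*n≡n+n m)) (+-monoʳ-≤ m j≤m))

seqEntry-fstar-suc-≡ : ∀ {n} → 3 ≤ n → seqEntry (fstar (suc n)) n ≡ seqEntry (fstar n) n +ℤ 1ℤ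
seqEntry-fstar-suc-≡ (s≤s (s≤s (s≤s {n = m} _))) = begin
  seqEntry (fstar (4 + m)) (3 + m)
    ≡⟨ seqEntry-fstar-suc (suc m) (sym (trans (*-suc 2 m) (cong (2 +_) (2*n≡n+n m)))) ≤-refl ⟩
  seqEntry (fstar (3 + m)) (3 + m) +ℤ coeff (mono (2 + m)) (2 + m)
    ≡⟨ cong (seqEntry (fstar (3 + m)) (3 + m) +ℤ_) (coeff-mono-≡ (2 + m)) ⟩
  seqEntry (fstar (3 + m)) (3 + m) +ℤ 1ℤ ∎
  where open ≡-Reasoning

seqEntry-fstar-stable : ∀ {n n′} → 2 ≤ n → n ≤′ n′ →
  ∀ i → 1 ≤ i → i < n → seqEntry (fstar n) i ≡ seqEntry (fstar n′) i
seqEntry-fstar-stable _   ≤′-refl            _ _   _   = refl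
seqEntry-fstar-stable 2≤n (≤′-step n≤′n′) i 1≤i i<n =
  trans (seqEntry-fstar-stable 2≤n n≤′n′ i 1≤i i<n)
        (sym (seqEntry-fstar-suc-< (≤-trans 2≤n n≤n′) 1≤i (<-≤-trans i<n n≤n′)))
  where n≤n′ = ≤′⇒≤ n≤′n′

seqEntry-fstar-increment : ∀ {n n′} → 3 ≤ n → n < n′ →
  seqEntry (fstar n′) n ≡ seqEntry (fstar n) n +ℤ 1ℤ
seqEntry-fstar-increment {n} 3≤n n<n′ = trans
  (sym (seqEntry-fstar-stable 2≤1+n (≤⇒≤′ n<n′) n (≤-trans (s≤s z≤n) 3≤n) (n<1+n n)))
  (seqEntry-fstar-suc-≡ 3≤n)
  where 2≤1+n = ≤-trans (n≤1+n 2) (m≤n⇒m≤1+n 3≤n)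

fstar-<lex : ∀ {n n′} → 3 ≤ n → n < n′ → fstar n <lex fstar n′
fstar-<lex {n} 3≤n n<n′ =
  n , ≤-trans (s≤s z≤n) 3≤n ,
  subst (x ℤ.<_) (sym (seqEntry-fstar-increment 3≤n n<n′))
        (ℤₚ.suc[i]≤j⇒i<j (ℤₚ.≤-reflexive (ℤₚ.+-comm 1ℤ x))) ,
  seqEntry-fstar-stable (≤-trans (n≤1+n 2) 3≤n) (≤⇒≤′ (<⇒≤ n<n′))
  where x = seqEntry (fstar n) n

leading-fstar : ∀ m → leading (fstar (2 + m)) ≡ 1ℤ
leading-fstar m = trans (cong (coeff (fstar (2 + m))) (deg-fstar m)) (coeff-fstar-leading m)

lemma3p39 :
    (∀ (n : ℕ) → 2 ≤ n → (deg (fstar n) ≡ 2 * n ∸ 4) × (leading (fstar n) ≡ 1ℤ))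
    × (∀ (n n′ : ℕ) → 3 ≤ n → n < n′ →
        (fstar n <lex fstar n′)
        × (∀ j → 1 ≤ j → j < n → seqEntry (fstar n) j ≡ seqEntry (fstar n′) j)
        × (∣ seqEntry (fstar n′) n - seqEntry (fstar n) n ∣ ≡ 1))
lemma3p39 =
  (λ { _ (s≤s (s≤s {n = m} _)) →
         trans (deg-fstar m) (cong (_∸ 4) (sym (trans (*-suc 2 (suc m)) (cong (2 +_) (*-suc 2 m))))) ,
         leading-fstar m }) ,
  λ n n′ 3≤n n<n′ →
    fstar-<lex 3≤n n<n′ ,
    seqEntry-fstar-stable (≤-trans (n≤1+n 2) 3≤n) (≤⇒≤′ (<⇒≤ n<n′)) ,
    cong ∣_∣ (trans (cong (_- seqEntry (fstar n) n) (seqEntry-fstar-increment 3≤n n<n′))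
                    (xyx⁻¹≈y (seqEntry (fstar n) n) 1ℤ))
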